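{- For every finite multiset $\Gamma$ of formulas and every formula $C$: $\Gamma\Rightarrow C$ is derivable in $\mathsf{GWFI}$ if and only if $\vdash_{\mathsf{WFI}}\bigwedge\Gamma\rightarrow C$.
   Context: Formulas are built from a countable set of propositional atoms and $\bot$ using $\wedge,\vee,\rightarrow$; $A\leftrightarrow B$ abbreviates $(A\rightarrow B)\wedge(B\rightarrow A)$. $\bigwedge\Gamma$ is the conjunction of the formulas of $\Gamma$ (empty conjunction read as $\bot\rightarrow\bot$). Sequent calculus $\mathsf{GWFI}$ (sequents $\Gamma\Rightarrow C$, $\Gamma$ finite multiset, $C$ a formula, $p$ atomic): (Ax) $p,\Gamma\Rightarrow p$; ($\bot_L$) $\bot,\Gamma\Rightarrow C$; ($\wedge_L$) from $A,B,\Gamma\Rightarrow C$ infer $A\wedge B,\Gamma\Rightarrow C$; ($\wedge_R$) from $\Gamma\Rightarrow A$ and $\Gamma\Rightarrow B$ infer $\Gamma\Rightarrow A\wedge B$; ($\vee_L$) from $A,\Gamma\Rightarrow C$ and $B,\Gamma\Rightarrow C$ infer $A\vee B,\Gamma\Rightarrow C$; ($\vee_R^1$) from $\Gamma\Rightarrow A$ infer $\Gamma\Rightarrow A\vee B$; ($\vee_R^2$) from $\Gamma\Rightarrow B$ infer $\Gamma\Rightarrow A\vee B$; ($\rightarrow_R$) from $A\Rightarrow B$ infer $\Gamma\Rightarrow A\rightarrow B$; ($\rightarrow_{LR}$) from $A\Rightarrow B$, $B\Rightarrow A$, $C\Rightarrow D$, $D\Rightarrow C$ infer $\Gamma,A\rightarrow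 C\Rightarrow B\rightarrow D$; ($\rightarrow_I$) from $\Gamma\Rightarrow B\rightarrow C$ and $\Gamma\Rightarrow C\rightarrow D$ infer $\Gamma\Rightarrow B\rightarrow D$. Hilbert system $\mathsf{WF}$: axioms all instances of $A\rightarrow(A\vee B)$; $B\rightarrow(A\vee B)$; $(A\wedge B)\rightarrow A$; $(A\wedge B)\rightarrow B$; $A\wedge(B\vee C)\rightarrow(A\wedge B)\vee(A\wedge C)$; $A\rightarrow A$; $\bot\rightarrow A$; rules: from $A$, $A\rightarrow B$ infer $B$; from $A$ infer $B\rightarrow A$; from $A\rightarrow B$, $B\rightarrow C$ infer $A\rightarrow C$; from $A\rightarrow B$, $A\rightarrow C$ infer $A\rightarrow(B\wedge C)$; from $A\rightarrow C$, $B\rightarrow C$ infer $(A\vee B)\rightarrow C$; from $A$, $B$ infer $A\wedge B$; from $A\leftrightarrow B$, $C\leftrightarrow D$ infer $(A\rightarrow C)\leftrightarrow(B\rightarrow D)$. $\mathsf{WFI}$ is $\mathsf{WF}$ plus all instances of the axiom $(A\rightarrow B)\wedge(B\rightarrow C)\rightarrow(A\rightarrow C)$. -}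

module Defs where

open import Data.Nat using (ℕ)
open import Data.List using (List; []; _∷_)
open import Data.List.Relation.Binary.Permutation.Propositional using (_↭_)

infixr 6 _∧_
infixr 5 _∨_
infixr 4 _⇒_
infix 3 _↔_

data Formula : Set where
  atom : ℕ → Formula
  ⊥'   : Formula
  _∧_  : Formula → Formula → Formula
  _∨_  : Formula → Formula → Formula
  _⇒_  : Formula → Formula → Formula

_↔_ : Formula → Formula → Formula
A ↔ B = (A ⇒ B) ∧ (B ⇒ A)

⋀ : List Formula → Formula
⋀ []          = ⊥' ⇒ ⊥'
⋀ (A ∷ [])    = A
⋀ (A ∷ B ∷ Γ) = A ∧ ⋀ (B ∷ Γ)

-- Sequent calculus GWFI.  Contexts are finite multisets, represented as
-- lists taken up to permutation: a rule whose conclusion has context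
-- "A , Γ" applies to any list Δ with Δ ↭ A ∷ Γ.
infix 2 _⊢G_
data _⊢G_ : List Formula → Formula → Set where
  Ax  : ∀ {Δ Γ} p → Δ ↭ (atom p ∷ Γ) → Δ ⊢G atom p
  ⊥L  : ∀ {Δ Γ C} → Δ ↭ (⊥' ∷ Γ) → Δ ⊢G C
  ∧L  : ∀ {Δ Γ A B C} → Δ ↭ ((A ∧ B) ∷ Γ) →
        (A ∷ B ∷ Γ) ⊢G C → Δ ⊢G C
  ∧R  : ∀ {Γ A B} → Γ ⊢G A → Γ ⊢G B → Γ ⊢G A ∧ B
  ∨L  : ∀ {Δ Γ A B C} → Δ ↭ ((A ∨ B) ∷ Γ) →
        (A ∷ Γ) ⊢G C → (B ∷ Γ) ⊢G C → Δ ⊢G C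
  ∨R1 : ∀ {Γ A B} → Γ ⊢G A → Γ ⊢G A ∨ B
  ∨R2 : ∀ {Γ A B} → Γ ⊢G B → Γ ⊢G A ∨ B
  ⇒R  : ∀ {Γ A B} → (A ∷ []) ⊢G B → Γ ⊢G A ⇒ B
  ⇒LR : ∀ {Δ Γ A B C D} → Δ ↭ ((A ⇒ C) ∷ Γ) →
        (A ∷ []) ⊢G B → (B ∷ []) ⊢G A →
        (C ∷ []) ⊢G D → (D ∷ []) ⊢G C →
        Δ ⊢G B ⇒ D
  ⇒I  : ∀ {Γ B C D} → Γ ⊢G B ⇒ C → Γ ⊢G C ⇒ D → Γ ⊢G B ⇒ D

data Axiom : Formula → Set where
  ∨i1   : ∀ A B → Axiom (A ⇒ A ∨ B)
  ∨i2   : ∀ A B → Axiom (B ⇒ A ∨ B)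
  ∧e1   : ∀ A B → Axiom (A ∧ B ⇒ A)
  ∧e2   : ∀ A B → Axiom (A ∧ B ⇒ B)
  dist  : ∀ A B C → Axiom (A ∧ (B ∨ C) ⇒ (A ∧ B) ∨ (A ∧ C))
  idA   : ∀ A → Axiom (A ⇒ A)
  exf   : ∀ A → Axiom (⊥' ⇒ A)

data AxiomI : Formula → Set where
  trans : ∀ A B C → AxiomI ((A ⇒ B) ∧ (B ⇒ C) ⇒ (A ⇒ C))

infix 2 ⊢WFI_
data ⊢WFI_ : Formula → Set where
  ax    : ∀ {A} → Axiom A → ⊢WFI A
  axI   : ∀ {A} → AxiomI A → ⊢WFI A
  mp    : ∀ {A B} → ⊢WFI A → ⊢WFI A ⇒ B → ⊢WFI B
  wk    : ∀ {A} B → ⊢WFI A → ⊢WFI B ⇒ A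
  tr    : ∀ {A B C} → ⊢WFI A ⇒ B → ⊢WFI B ⇒ C → ⊢WFI A ⇒ C
  ∧I⇒   : ∀ {A B C} → ⊢WFI A ⇒ B → ⊢WFI A ⇒ C → ⊢WFI A ⇒ B ∧ C
  ∨E⇒   : ∀ {A B C} → ⊢WFI A ⇒ C → ⊢WFI B ⇒ C → ⊢WFI A ∨ B ⇒ C
  adj   : ∀ {A B} → ⊢WFI A → ⊢WFI B → ⊢WFI A ∧ B
  cong⇒ : ∀ {A B C D} → ⊢WFI A ↔ B → ⊢WFI C ↔ D →
          ⊢WFI (A ⇒ C) ↔ (B ⇒ D)

{-# OPTIONS --safe #-}
module Submission where

-- Soundness is checked rule by rule, reading a context as the conjunction of its members:
-- ∨L needs distributivity, ⇒LR the congruence rule and ⇒I the transitivity axiom of WFI.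
-- For completeness each Hilbert rule is simulated in GWFI; modus ponens needs cut. Cut is
-- admissible because a principal cut on an implication is absorbed by the rule ⇒I, and
-- one on a conjunction or disjunction reduces to cuts on its components, once weakening,
-- contraction and the invertibility of ∧L and ∨L are available (`⊢-resp-⊑`).

open import Defs
open import Data.List using (List; []; _∷_)
open import Data.List.Membership.Propositional using (_∈_)
open import Data.List.Relation.Unary.Any using (here; there; _─_)
open import Data.List.Relation.Unary.All as All using (All; []; _∷_)
open import Data.List.Relation.Binary.Permutation.Propositional
  using (_↭_; refl; prep; swap; trans; ↭-sym)
open import Data.List.Relation.Binary.Permutation.Propositional.Properties
  using (All-resp-↭; ¬x∷xs↭[])
open import Data.Product using (_×_; _,_)
open import Data.Empty using (⊥-elim)
open import Relation.Binary.PropositionalEquality using (refl)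

infix 4 _⊩_

_⊩_ : Formula → List Formula → Set
H ⊩ Γ = All (λ X → ⊢WFI H ⇒ X) Γ

⋀-elim : ∀ Γ → ⋀ Γ ⊩ Γ
⋀-elim []          = []
⋀-elim (A ∷ [])    = ax (idA A) ∷ []
⋀-elim (A ∷ B ∷ Γ) = ax (∧e1 _ _) ∷ All.map (tr (ax (∧e2 _ _))) (⋀-elim (B ∷ Γ))

⋀-intro : ∀ {H Γ} → H ⊩ Γ → ⊢WFI H ⇒ ⋀ Γ
⋀-intro {H} []          = wk H (ax (idA ⊥'))
⋀-intro (p ∷ [])         = p
⋀-intro (p ∷ ps@(_ ∷ _)) = ∧I⇒ p (⋀-intro ps)

⋀-elim-↭ : ∀ {Δ X Γ} → Δ ↭ X ∷ Γ → ⋀ Δ ⊩ X ∷ Γ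
⋀-elim-↭ q = All-resp-↭ q (⋀-elim _)

∧-⋀⇒⋀-∷ : ∀ A Γ → ⊢WFI ⋀ Γ ∧ A ⇒ ⋀ (A ∷ Γ)
∧-⋀⇒⋀-∷ A Γ = ⋀-intro (ax (∧e2 _ _) ∷ All.map (tr (ax (∧e1 _ _))) (⋀-elim Γ))

soundness : ∀ {Γ C} → Γ ⊢G C → ⊢WFI ⋀ Γ ⇒ C
soundness (Ax p q) = All.head (⋀-elim-↭ q)
soundness (⊥L q)   = tr (All.head (⋀-elim-↭ q)) (ax (exf _))
soundness (∧L q d) with ⋀-elim-↭ q
... | p∧ ∷ ps =
  tr (⋀-intro (tr p∧ (ax (∧e1 _ _)) ∷ tr p∧ (ax (∧e2 _ _)) ∷ ps)) (soundness d)
soundness (∨L {Γ = Γ} {A} {B} q d e) with ⋀-elim-↭ q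
... | p∨ ∷ ps =
  tr (∧I⇒ (⋀-intro ps) p∨)
     (tr (ax (dist _ _ _))
         (∨E⇒ (tr (∧-⋀⇒⋀-∷ A Γ) (soundness d))
              (tr (∧-⋀⇒⋀-∷ B Γ) (soundness e))))
soundness (∧R d e)  = ∧I⇒ (soundness d) (soundness e)
soundness (∨R1 d)   = tr (soundness d) (ax (∨i1 _ _))
soundness (∨R2 d)   = tr (soundness d) (ax (∨i2 _ _))
soundness (⇒R d)    = wk _ (soundness d)
soundness (⇒LR q d₁ d₂ d₃ d₄) =
  tr (All.head (⋀-elim-↭ q))
     (mp (cong⇒ (adj (soundness d₁) (soundness d₂)) (adj (soundness d₃) (soundness d₄)))
         (ax (∧e1 _ _)))
soundness (⇒I d e)  = tr (∧I⇒ (soundness d) (soundness e)) (axI (trans _ _ _))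

∈⇒↭ : ∀ {X : Formula} {Δ} (m : X ∈ Δ) → Δ ↭ X ∷ (Δ ─ m)
∈⇒↭ (here refl)           = refl
∈⇒↭ {X} (there {x = Y} m) = trans (prep Y (∈⇒↭ m)) (swap Y X refl)

infix 4 _≼_ _⊑_

-- Since ∧L and ∨L are invertible, a context may be replaced by any context covering it
-- in the sense of ⊑ (`⊢-resp-⊑`); this subsumes weakening, contraction and exchange.

data _≼_ : Formula → List Formula → Set where
  member : ∀ {X Δ} → X ∈ Δ → X ≼ Δ
  conj   : ∀ {A B Δ} → A ≼ Δ → B ≼ Δ → A ∧ B ≼ Δ
  disjˡ  : ∀ {A B Δ} → A ≼ Δ → A ∨ B ≼ Δ
  disjʳ  : ∀ {A B Δ} → B ≼ Δ → A ∨ B ≼ Δ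

_⊑_ : List Formula → List Formula → Set
Γ ⊑ Δ = All (_≼ Δ) Γ

≼-trans : ∀ {X Γ Δ} → X ≼ Γ → Γ ⊑ Δ → X ≼ Δ
≼-trans (member m)  t = All.lookup t m
≼-trans (conj a b)  t = conj (≼-trans a t) (≼-trans b t)
≼-trans (disjˡ a)   t = disjˡ (≼-trans a t)
≼-trans (disjʳ b)   t = disjʳ (≼-trans b t)

⊑-refl : ∀ {Γ} → Γ ⊑ Γ
⊑-refl = All.tabulate member

⊑-trans : ∀ {Γ Θ Δ} → Γ ⊑ Θ → Θ ⊑ Δ → Γ ⊑ Δ
⊑-trans s t = All.map (λ x → ≼-trans x t) s

≼-here : ∀ {X Δ} → X ≼ X ∷ Δ
≼-here = member (here refl)

≼-there : ∀ {X Y Δ} → X ≼ Δ → X ≼ Y ∷ Δ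
≼-there x = ≼-trans x (All.tabulate (λ m → member (there m)))

⊑-there : ∀ {Y Γ Δ} → Γ ⊑ Δ → Γ ⊑ Y ∷ Δ
⊑-there = All.map ≼-there

⊑-cons : ∀ {X Γ Δ} → Γ ⊑ Δ → X ∷ Γ ⊑ X ∷ Δ
⊑-cons s = ≼-here ∷ ⊑-there s

∧-split : ∀ {A B Δ Δ′} → Δ ↭ (A ∧ B) ∷ Δ′ → Δ ⊑ A ∷ B ∷ Δ′
∧-split q =
  All-resp-↭ (↭-sym q) (conj ≼-here (≼-there ≼-here) ∷ ⊑-there (⊑-there ⊑-refl))

∨-split₁ : ∀ {A B Δ Δ′} → Δ ↭ (A ∨ B) ∷ Δ′ → Δ ⊑ A ∷ Δ′
∨-split₁ q = All-resp-↭ (↭-sym q) (disjˡ ≼-here ∷ ⊑-there ⊑-refl)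

∨-split₂ : ∀ {A B Δ Δ′} → Δ ↭ (A ∨ B) ∷ Δ′ → Δ ⊑ B ∷ Δ′
∨-split₂ q = All-resp-↭ (↭-sym q) (disjʳ ≼-here ∷ ⊑-there ⊑-refl)

⊢-resp-⊑ : ∀ {Γ Δ C} → Γ ⊢G C → Γ ⊑ Δ → Δ ⊢G C
⊢-resp-⊑ (Ax p q) s with All.head (All-resp-↭ q s)
... | member m = Ax p (∈⇒↭ m)
⊢-resp-⊑ (⊥L q) s with All.head (All-resp-↭ q s)
... | member m = ⊥L (∈⇒↭ m)
⊢-resp-⊑ (∧L q d) s with All-resp-↭ q s
... | member m ∷ s′ =
  ∧L (∈⇒↭ m) (⊢-resp-⊑ d (≼-here ∷ ≼-there ≼-here ∷ ⊑-trans s′ (∧-split (∈⇒↭ m))))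
... | conj a b ∷ s′ = ⊢-resp-⊑ d (a ∷ b ∷ s′)
⊢-resp-⊑ (∨L q d e) s with All-resp-↭ q s
... | member m ∷ s′ =
  ∨L (∈⇒↭ m) (⊢-resp-⊑ d (≼-here ∷ ⊑-trans s′ (∨-split₁ (∈⇒↭ m))))
             (⊢-resp-⊑ e (≼-here ∷ ⊑-trans s′ (∨-split₂ (∈⇒↭ m))))
... | disjˡ a ∷ s′  = ⊢-resp-⊑ d (a ∷ s′)
... | disjʳ b ∷ s′  = ⊢-resp-⊑ e (b ∷ s′)
⊢-resp-⊑ (∧R d e) s = ∧R (⊢-resp-⊑ d s) (⊢-resp-⊑ e s)
⊢-resp-⊑ (∨R1 d) s  = ∨R1 (⊢-resp-⊑ d s)
⊢-resp-⊑ (∨R2 d) s  = ∨R2 (⊢-resp-⊑ d s)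
⊢-resp-⊑ (⇒R d) s   = ⇒R d
⊢-resp-⊑ (⇒LR q d₁ d₂ d₃ d₄) s with All.head (All-resp-↭ q s)
... | member m = ⇒LR (∈⇒↭ m) d₁ d₂ d₃ d₄
⊢-resp-⊑ (⇒I d e) s = ⇒I (⊢-resp-⊑ d s) (⊢-resp-⊑ e s)

⊢⊥-elim : ∀ {Γ C} → Γ ⊢G ⊥' → Γ ⊢G C
⊢⊥-elim (⊥L q)     = ⊥L q
⊢⊥-elim (∧L q d)   = ∧L q (⊢⊥-elim d)
⊢⊥-elim (∨L q d e) = ∨L q (⊢⊥-elim d) (⊢⊥-elim e)

∧R⁻¹ : ∀ {Γ A B} → Γ ⊢G A ∧ B → (Γ ⊢G A) × (Γ ⊢G B)
∧R⁻¹ (⊥L q) = ⊥L q , ⊥L q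
∧R⁻¹ (∧L q d) with ∧R⁻¹ d
... | a , b = ∧L q a , ∧L q b
∧R⁻¹ (∨L q d e) with ∧R⁻¹ d | ∧R⁻¹ e
... | a , b | a′ , b′ = ∨L q a a′ , ∨L q b b′
∧R⁻¹ (∧R a b) = a , b

-- Allowing Δ ⊑ A ∷ Γ rather than Δ ≡ A ∷ Γ lets the induction on the right premise
-- absorb contraction of the cut formula.
cut : ∀ {Γ Δ A C} → Γ ⊢G A → Δ ⊢G C → Δ ⊑ A ∷ Γ → Γ ⊢G C
cut-∧ : ∀ {Γ A B C} → (Γ ⊢G A) × (Γ ⊢G B) → A ∷ B ∷ Γ ⊢G C → Γ ⊢G C
cut-∨ : ∀ {Γ A B C} → Γ ⊢G A ∨ B → A ∷ Γ ⊢G C → B ∷ Γ ⊢G C → Γ ⊢G C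

cut L (Ax p q) s with All.head (All-resp-↭ q s)
... | member (here refl) = L
... | member (there m)   = Ax p (∈⇒↭ m)
cut L (⊥L q) s with All.head (All-resp-↭ q s)
... | member (here refl) = ⊢⊥-elim L
... | member (there m)   = ⊥L (∈⇒↭ m)
cut L (∧L q d) s with All-resp-↭ q s
... | member (here refl) ∷ s′ =
  cut-∧ (∧R⁻¹ L) (⊢-resp-⊑ d (≼-here ∷ ≼-there ≼-here ∷ ⊑-trans s′ (∧-split refl)))
... | member (there m) ∷ s′ =
  ∧L q′ (cut (⊢-resp-⊑ L Γ⊑) d
             (≼-there ≼-here ∷ ≼-there (≼-there ≼-here) ∷ ⊑-trans s′ (⊑-cons Γ⊑)))
  where
  q′ = ∈⇒↭ m
  Γ⊑ = ∧-split q′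
... | conj a b ∷ s′ = cut L d (a ∷ b ∷ s′)
cut L (∨L q d e) s with All-resp-↭ q s
... | member (here refl) ∷ s′ =
  cut-∨ L (⊢-resp-⊑ d (≼-here ∷ ⊑-trans s′ (∨-split₁ refl)))
          (⊢-resp-⊑ e (≼-here ∷ ⊑-trans s′ (∨-split₂ refl)))
... | member (there m) ∷ s′ =
  ∨L q′ (cut (⊢-resp-⊑ L Γ⊑₁) d (≼-there ≼-here ∷ ⊑-trans s′ (⊑-cons Γ⊑₁)))
        (cut (⊢-resp-⊑ L Γ⊑₂) e (≼-there ≼-here ∷ ⊑-trans s′ (⊑-cons Γ⊑₂)))
  where
  q′ = ∈⇒↭ m
  Γ⊑₁ = ∨-split₁ q′
  Γ⊑₂ = ∨-split₂ q′
... | disjˡ a ∷ s′ = cut L d (a ∷ s′)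
... | disjʳ b ∷ s′ = cut L e (b ∷ s′)
cut L (∧R d e) s = ∧R (cut L d s) (cut L e s)
cut L (∨R1 d) s  = ∨R1 (cut L d s)
cut L (∨R2 d) s  = ∨R2 (cut L d s)
cut L (⇒R d) s   = ⇒R d
cut L (⇒LR q d₁ d₂ d₃ d₄) s with All.head (All-resp-↭ q s)
... | member (here refl) = ⇒I (⇒I (⇒R d₂) L) (⇒R d₃)
... | member (there m)   = ⇒LR (∈⇒↭ m) d₁ d₂ d₃ d₄
cut L (⇒I d e) s = ⇒I (cut L d s) (cut L e s)

cut-∧ (a , b) r = cut a (cut b′ r (All-resp-↭ (swap _ _ refl) ⊑-refl)) ⊑-refl
  where
  b′ = ⊢-resp-⊑ b (⊑-there ⊑-refl)

cut-∨ (∨R1 a)   r₁ r₂ = cut a r₁ ⊑-refl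
cut-∨ (∨R2 b)   r₁ r₂ = cut b r₂ ⊑-refl
cut-∨ (⊥L q)    r₁ r₂ = ⊥L q
cut-∨ (∧L q d)  r₁ r₂ =
  ∧L q (cut-∨ d (⊢-resp-⊑ r₁ (⊑-cons (∧-split q))) (⊢-resp-⊑ r₂ (⊑-cons (∧-split q))))
cut-∨ (∨L q d e) r₁ r₂ =
  ∨L q (cut-∨ d (⊢-resp-⊑ r₁ (⊑-cons (∨-split₁ q))) (⊢-resp-⊑ r₂ (⊑-cons (∨-split₁ q))))
       (cut-∨ e (⊢-resp-⊑ r₁ (⊑-cons (∨-split₂ q))) (⊢-resp-⊑ r₂ (⊑-cons (∨-split₂ q))))

⊢-refl : ∀ A → A ∷ [] ⊢G A
∈⇒⊢ : ∀ {A Γ} → A ∈ Γ → Γ ⊢G A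

⊢-refl (atom p) = Ax p refl
⊢-refl ⊥'       = ⊥L refl
⊢-refl (A ∧ B)  = ∧L refl (∧R (∈⇒⊢ (here refl)) (∈⇒⊢ (there (here refl))))
⊢-refl (A ∨ B)  = ∨L refl (∨R1 (⊢-refl A)) (∨R2 (⊢-refl B))
⊢-refl (A ⇒ B)  = ⇒LR refl (⊢-refl A) (⊢-refl A) (⊢-refl B) (⊢-refl B)

∈⇒⊢ {A} m = ⊢-resp-⊑ (⊢-refl A) (member m ∷ [])

⇒R⁻¹ : ∀ {A B} → [] ⊢G A ⇒ B → A ∷ [] ⊢G B
⇒R⁻¹ (⇒R d)              = d
⇒R⁻¹ (⇒I d e)            = cut (⇒R⁻¹ d) (⇒R⁻¹ e) (≼-here ∷ [])
⇒R⁻¹ (⊥L q)              = ⊥-elim (¬x∷xs↭[] (↭-sym q))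
⇒R⁻¹ (∧L q d)            = ⊥-elim (¬x∷xs↭[] (↭-sym q))
⇒R⁻¹ (∨L q d e)          = ⊥-elim (¬x∷xs↭[] (↭-sym q))
⇒R⁻¹ (⇒LR q d₁ d₂ d₃ d₄) = ⊥-elim (¬x∷xs↭[] (↭-sym q))

⊢WFI⇒⊢G : ∀ {F} → ⊢WFI F → [] ⊢G F
⊢WFI⇒⊢G (ax (∨i1 A B))   = ⇒R (∨R1 (⊢-refl A))
⊢WFI⇒⊢G (ax (∨i2 A B))   = ⇒R (∨R2 (⊢-refl B))
⊢WFI⇒⊢G (ax (∧e1 A B))   = ⇒R (∧L refl (∈⇒⊢ (here refl)))
⊢WFI⇒⊢G (ax (∧e2 A B))   = ⇒R (∧L refl (∈⇒⊢ (there (here refl))))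
⊢WFI⇒⊢G (ax (dist A B C)) =
  ⇒R (∧L refl (∨L (swap A (B ∨ C) refl)
    (∨R1 (∧R (∈⇒⊢ (there (here refl))) (∈⇒⊢ (here refl))))
    (∨R2 (∧R (∈⇒⊢ (there (here refl))) (∈⇒⊢ (here refl))))))
⊢WFI⇒⊢G (ax (idA A))     = ⇒R (⊢-refl A)
⊢WFI⇒⊢G (ax (exf A))     = ⇒R (⊥L refl)
⊢WFI⇒⊢G (axI (trans A B C)) =
  ⇒R (∧L refl (⇒I (∈⇒⊢ (here refl)) (∈⇒⊢ (there (here refl)))))
⊢WFI⇒⊢G (mp a b)   = cut (⊢WFI⇒⊢G a) (⇒R⁻¹ (⊢WFI⇒⊢G b)) ⊑-refl
⊢WFI⇒⊢G (wk B a)   = ⇒R (⊢-resp-⊑ (⊢WFI⇒⊢G a) [])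
⊢WFI⇒⊢G (tr a b)   = ⇒I (⊢WFI⇒⊢G a) (⊢WFI⇒⊢G b)
⊢WFI⇒⊢G (∧I⇒ a b)  = ⇒R (∧R (⇒R⁻¹ (⊢WFI⇒⊢G a)) (⇒R⁻¹ (⊢WFI⇒⊢G b)))
⊢WFI⇒⊢G (∨E⇒ a b)  = ⇒R (∨L refl (⇒R⁻¹ (⊢WFI⇒⊢G a)) (⇒R⁻¹ (⊢WFI⇒⊢G b)))
⊢WFI⇒⊢G (adj a b)  = ∧R (⊢WFI⇒⊢G a) (⊢WFI⇒⊢G b)
⊢WFI⇒⊢G (cong⇒ a b) with ∧R⁻¹ (⊢WFI⇒⊢G a) | ∧R⁻¹ (⊢WFI⇒⊢G b)
... | ab , ba | cd , dc =
  ∧R (⇒R (⇒LR refl (⇒R⁻¹ ab) (⇒R⁻¹ ba) (⇒R⁻¹ cd) (⇒R⁻¹ dc)))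
     (⇒R (⇒LR refl (⇒R⁻¹ ba) (⇒R⁻¹ ab) (⇒R⁻¹ dc) (⇒R⁻¹ cd)))

⋀-≼ : ∀ A Γ → ⋀ (A ∷ Γ) ≼ A ∷ Γ
⋀-≼ A []      = ≼-here
⋀-≼ A (B ∷ Γ) = conj ≼-here (≼-there (⋀-≼ B Γ))

completeness : ∀ Γ {C} → ⊢WFI ⋀ Γ ⇒ C → Γ ⊢G C
completeness []      h = cut (⇒R (⊥L refl)) (⇒R⁻¹ (⊢WFI⇒⊢G h)) ⊑-refl
completeness (A ∷ Γ) h = ⊢-resp-⊑ (⇒R⁻¹ (⊢WFI⇒⊢G h)) (⋀-≼ A Γ ∷ [])

mainTheorem12 : (Γ : List Formula) (C : Formula) →
    ((Γ ⊢G C) → (⊢WFI ⋀ Γ ⇒ C)) × ((⊢WFI ⋀ Γ ⇒ C) → (Γ ⊢G C))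
mainTheorem12 Γ C = soundness , completeness Γ
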